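{- Let $H$ be a hypergraph, $k$ a positive integer, and $S\subseteq V(H)$ such that $\rho(S)>3k$ and $\rho(S)$ is not a multiple of $3$. Let $X$ be a balanced separator for $S$ with $\rho(X)\le k$. Then $H\setminus X$ is the union of two vertex-disjoint (hence edge-disjoint) subhypergraphs $H_1$ and $H_2$ such that $\rho(S\cap V(H_i))<\frac23\rho(S)$ for each $i\in\{1,2\}$.
   Context: A hypergraph $H$ has a finite vertex set $V(H)$ and a family $E(H)$ of subsets (hyperedges), with no isolated vertices. For $U\subseteq V(H)$, $H[U]$ has vertex set $U$ and hyperedges $\{e\cap U:e\in E(H), e\cap U\ne\emptyset\}$, $H\setminus U=H[V(H)\setminus U]$, and connected components are defined via paths (vertex sequences with consecutive vertices in a common hyperedge). $\rho(U)$ is the smallest number of hyperedges of $H$ whose union contains $U$. $X$ is a balanced separator for $S$ if every connected component $V'$ of $H\setminus X$ satisfies $\rho(V'\cap S)<\frac23\rho(S)$. -}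

module Defs where

open import Data.Nat using (ℕ; _*_; _<_)
open import Data.Fin using (Fin)
open import Data.Fin.Subset using (Subset; _∈_; _∉_; _∩_)
open import Data.Product using (Σ; ∃; _×_; _,_)
open import Data.Sum using (_⊎_)

record Hypergraph : Set where
  field
    n      : ℕ
    m      : ℕ
    edge   : Fin m → Subset n
    noIsol : ∀ (v : Fin n) → ∃ λ i → v ∈ edge i

open Hypergraph public

Covers : (H : Hypergraph) → Subset (n H) → ℕ → Set
Covers H U r = Σ (Fin r → Fin (m H)) λ f →
  ∀ v → v ∈ U → ∃ λ j → v ∈ edge H (f j)

IsRho : (H : Hypergraph) → Subset (n H) → ℕ → Set
IsRho H U r = Covers H U r × (∀ r' → Covers H U r' → r Data.Nat.≤ r')

-- Reach H X u w : there is a path from u to w in H ∖ X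
-- (all vertices outside X, consecutive vertices in a common hyperedge of H∖X,
-- i.e. both lie in e ∩ (V ∖ X) for some e ∈ E(H)).
data Reach (H : Hypergraph) (X : Subset (n H)) (u : Fin (n H)) : Fin (n H) → Set where
  here : u ∉ X → Reach H X u u
  step : ∀ {v w} → Reach H X u v → w ∉ X →
         (∃ λ i → v ∈ edge H i × w ∈ edge H i) → Reach H X u w

IsComponent : (H : Hypergraph) → Subset (n H) → Subset (n H) → Set
IsComponent H X V' = ∃ λ u → u ∉ X ×
  (∀ w → (w ∈ V' → Reach H X u w) × (Reach H X u w → w ∈ V'))

BalancedSeparator : (H : Hypergraph) → Subset (n H) → Subset (n H) → Set
BalancedSeparator H S X = ∀ rS → IsRho H S rS → ∀ V' → IsComponent H X V' →
  ∀ r → IsRho H (V' ∩ S) r → 3 * r < 2 * rS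

{-# OPTIONS --safe #-}
-- Fix an optimal cover of S by ρ(S) edges and measure a set A of vertices of H ∖ X by
-- μ(A), the number of cover edges meeting A.  Then ρ(S ∩ A) ≤ μ(A), μ is subadditive,
-- and μ(A) + μ(A′) ≤ ρ(S) when A is a union of components of H ∖ X and A′ the rest
-- of H ∖ X, since no edge meets both.  Sweep through the components, accumulating them
-- in A while 3μ(A) < ρ(S).  If adding a component C breaks this, then 3μ(A ∪ C) > ρ(S)
-- as 3 ∤ ρ(S); either 3μ(A ∪ C) < 2ρ(S) and we split off A ∪ C, or 3μ(C) > ρ(S) and we
-- split off C, whose own bound comes from the balanced separator.  Either way the part
-- split off has μ > ρ(S)/3, so the rest has μ < 2ρ(S)/3.  If the sweep never stops, A
-- is all of H ∖ X.
module Submission where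

open import Defs
import Data.Nat as ℕ
open import Data.Nat using (ℕ; _*_; _<_; _≤_; _+_; _∸_; z≤n; s≤s; _<?_)
open import Data.Nat.Properties
open import Data.Nat.Divisibility using (_∣_; divides)
open import Data.Fin using (Fin; zero; suc)
open import Data.Fin.Properties using (any?)
open import Data.Fin.Subset
  using (Subset; ⊥; _∈_; _∉_; _∩_; _∪_; _⊆_; _⊃_; ∁; ∣_∣; ⁅_⁆; inside; outside; Empty)
open import Data.Fin.Subset.Properties
  using (_∈?_; x∈p∩q⁻; x∈p∪q⁺; x∈p∪q⁻; p⊆p∪q; x∈⁅x⁆; x∈⁅y⁆⇒x≡y;
         x∉p⇒x∈∁p; x∈∁p⇒x∉p; x∉∁p⇒x∈p; p⊆q⇒∣p∣≤∣q∣; ∣∁p∣≡n∸∣p∣; ∣p∣≤n; ∣p∣≤∣x∷p∣;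
         Empty-unique; ∉⊥; ∣⊥∣≡0; ∩-comm)
open import Data.Fin.Subset.Induction using (Acc; acc; ⊃-wellFounded)
open import Data.List using (List; []; _∷_; allFin)
open import Data.List.Membership.Propositional using () renaming (_∈_ to _∈ₗ_)
open import Data.List.Membership.Propositional.Properties using (∈-allFin)
import Data.List.Relation.Unary.Any as Any
open import Data.Vec using ([]; _∷_; tabulate; here; there)
open import Data.Vec.Properties using (lookup∘tabulate; lookup⇒[]=; []=⇒lookup)
open import Data.Empty using (⊥-elim)
open import Function using (_∘_)
open import Data.Product using (Σ; ∃; _×_; _,_; proj₁; proj₂)
open import Data.Sum using (_⊎_; inj₁; inj₂; [_,_]′)
open import Relation.Nullary using (¬_; Dec; yes; no; does)
open import Relation.Nullary.Decidable using (_×-dec_; ¬?; dec-true; decidable-stable)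
open import Relation.Unary using (Pred; Decidable)
open import Relation.Binary.PropositionalEquality using (_≡_; refl; sym; trans; subst; cong)


∣p∪q∣≤∣p∣+∣q∣ : ∀ {r} (p q : Subset r) → ∣ p ∪ q ∣ ≤ ∣ p ∣ + ∣ q ∣
∣p∪q∣≤∣p∣+∣q∣ [] [] = z≤n
∣p∪q∣≤∣p∣+∣q∣ (inside ∷ p) (x ∷ q) =
  s≤s (≤-trans (∣p∪q∣≤∣p∣+∣q∣ p q) (+-monoʳ-≤ ∣ p ∣ (∣p∣≤∣x∷p∣ x q)))
∣p∪q∣≤∣p∣+∣q∣ (outside ∷ p) (inside ∷ q) =
  ≤-trans (s≤s (∣p∪q∣≤∣p∣+∣q∣ p q)) (≤-reflexive (sym (+-suc ∣ p ∣ ∣ q ∣)))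
∣p∪q∣≤∣p∣+∣q∣ (outside ∷ p) (outside ∷ q) = ∣p∪q∣≤∣p∣+∣q∣ p q

q⊆∁p⇒∣p∣+∣q∣≤n : ∀ {r} (p q : Subset r) → q ⊆ ∁ p → ∣ p ∣ + ∣ q ∣ ≤ r
q⊆∁p⇒∣p∣+∣q∣≤n {r} p q q⊆∁p = begin
  ∣ p ∣ + ∣ q ∣       ≤⟨ +-monoʳ-≤ ∣ p ∣ (p⊆q⇒∣p∣≤∣q∣ q⊆∁p) ⟩
  ∣ p ∣ + ∣ ∁ p ∣     ≡⟨ cong (∣ p ∣ +_) (∣∁p∣≡n∸∣p∣ p) ⟩
  ∣ p ∣ + (r ∸ ∣ p ∣) ≡⟨ m+[n∸m]≡n (∣p∣≤n p) ⟩
  r                   ∎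
  where open ≤-Reasoning

enumerate : ∀ {r} (p : Subset r) → Σ (Fin ∣ p ∣ → Fin r) λ g → ∀ {j} → j ∈ p → ∃ λ k → g k ≡ j
enumerate [] = (λ ()) , λ ()
enumerate (inside ∷ p) = g , covered
  where
  g : Fin (ℕ.suc ∣ p ∣) → Fin (ℕ.suc _)
  g zero = zero
  g (suc k) = suc (proj₁ (enumerate p) k)
  covered : ∀ {j} → j ∈ inside ∷ p → ∃ λ k → g k ≡ j
  covered here = zero , refl
  covered (there j∈p) with proj₂ (enumerate p) j∈p
  ... | k , refl = suc k , refl
enumerate (outside ∷ p) = (λ k → suc (proj₁ (enumerate p) k)) , covered
  where
  covered : ∀ {j} → j ∈ outside ∷ p → ∃ λ k → suc (proj₁ (enumerate p) k) ≡ j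
  covered (there j∈p) with proj₂ (enumerate p) j∈p
  ... | k , refl = k , refl

module _ {ℓ} {r : ℕ} {P : Pred (Fin r) ℓ} (P? : Decidable P) where

  ∈-tabulate-does⁺ : ∀ {j} → P j → j ∈ tabulate (does ∘ P?)
  ∈-tabulate-does⁺ {j} pj =
    lookup⇒[]= j _ (trans (lookup∘tabulate (does ∘ P?) j) (dec-true (P? j) pj))

  ∈-tabulate-does⁻ : ∀ {j} → j ∈ tabulate (does ∘ P?) → P j
  ∈-tabulate-does⁻ {j} j∈ with P? j | trans (sym (lookup∘tabulate (does ∘ P?) j)) ([]=⇒lookup j∈)
  ... | yes pj | _ = pj

≮⇒>-nonMultiple : ∀ a R → ¬ (3 ∣ R) → ¬ (3 * a < R) → R < 3 * a
≮⇒>-nonMultiple a R 3∤R ≮ = ≤∧≢⇒< (≮⇒≥ ≮) λ R≡3a → 3∤R (divides a (trans R≡3a (*-comm 3 a)))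

thirds-complement : ∀ x y R → x + y ≤ R → R < 3 * x → 3 * y < 2 * R
thirds-complement x y R x+y≤R R<3x = +-cancelʳ-< R (3 * y) (2 * R) (begin-strict
  3 * y + R     <⟨ +-monoʳ-< (3 * y) R<3x ⟩
  3 * y + 3 * x ≡⟨ +-comm (3 * y) (3 * x) ⟩
  3 * x + 3 * y ≡⟨ *-distribˡ-+ 3 x y ⟨
  3 * (x + y)   ≤⟨ *-monoʳ-≤ 3 x+y≤R ⟩
  R + 2 * R     ≡⟨ +-comm R (2 * R) ⟩
  2 * R + R     ∎)
  where open ≤-Reasoning

thirds-crossing : ∀ a a′ c R → 3 * a < R → a′ ≤ a + c → 2 * R ≤ 3 * a′ → R < 3 * c
thirds-crossing a a′ c R 3a<R a′≤a+c 2R≤3a′ = +-cancelˡ-< R R (3 * c) (begin-strict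
  R + R         ≡⟨ cong (R +_) (+-identityʳ R) ⟨
  2 * R         ≤⟨ 2R≤3a′ ⟩
  3 * a′        ≤⟨ *-monoʳ-≤ 3 a′≤a+c ⟩
  3 * (a + c)   ≡⟨ *-distribˡ-+ 3 a c ⟩
  3 * a + 3 * c <⟨ +-monoˡ-< (3 * c) 3a<R ⟩
  R + 3 * c     ∎)
  where open ≤-Reasoning

module _ (H : Hypergraph) (X : Subset (n H)) where

  Adjacent : Fin (n H) → Fin (n H) → Set
  Adjacent v w = ∃ λ i → v ∈ edge H i × w ∈ edge H i

  adjacent? : ∀ v w → Dec (Adjacent v w)
  adjacent? v w = any? λ i → v ∈? edge H i ×-dec w ∈? edge H i

  Free : Subset (n H) → Set
  Free A = ∀ v → v ∈ A → v ∉ X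

  Closed : Subset (n H) → Set
  Closed A = ∀ {v w} → v ∈ A → w ∉ X → Adjacent v w → w ∈ A

  Reachable : Fin (n H) → Subset (n H) → Set
  Reachable u A = ∀ {w} → w ∈ A → Reach H X u w

  ComponentOf : Fin (n H) → Set
  ComponentOf u = Σ (Subset (n H)) λ C → u ∈ C × Closed C × Reachable u C

  private
    Escape : Subset (n H) → Set
    Escape A = ∃ λ v → ∃ λ w → v ∈ A × w ∉ A × w ∉ X × Adjacent v w

    escape? : ∀ A → Dec (Escape A)
    escape? A = any? λ v → any? λ w →
      v ∈? A ×-dec ¬? (w ∈? A) ×-dec ¬? (w ∈? X) ×-dec adjacent? v w

    grow : ∀ {u} A → Acc _⊃_ A → u ∈ A → Reachable u A → ComponentOf u
    grow {u} A (acc smaller) u∈A reach with escape? A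
    ... | no stuck = A , u∈A , closed , reach
      where
      closed : Closed A
      closed {v} {w} v∈A w∉X adj =
        decidable-stable (w ∈? A) λ w∉A → stuck (v , w , v∈A , w∉A , w∉X , adj)
    ... | yes (v , w , v∈A , w∉A , w∉X , adj) =
      grow (A ∪ ⁅ w ⁆) (smaller A⊂A∪⁅w⁆) (p⊆p∪q ⁅ w ⁆ u∈A) reach′
      where
      A⊂A∪⁅w⁆ : (A ∪ ⁅ w ⁆) ⊃ A
      A⊂A∪⁅w⁆ = p⊆p∪q ⁅ w ⁆ , w , x∈p∪q⁺ (inj₂ (x∈⁅x⁆ w)) , w∉A
      reach′ : Reachable u (A ∪ ⁅ w ⁆)
      reach′ {x} x∈ with x∈p∪q⁻ A ⁅ w ⁆ x∈
      ... | inj₁ x∈A = reach x∈A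
      ... | inj₂ x∈⁅w⁆ with x∈⁅y⁆⇒x≡y w x∈⁅w⁆
      ... | refl = step (reach v∈A) w∉X adj

  reach-free : ∀ {u w} → Reach H X u w → w ∉ X
  reach-free (here w∉X) = w∉X
  reach-free (step _ w∉X _) = w∉X

  reachable-free : ∀ {u A} → Reachable u A → Free A
  reachable-free reach _ w∈A = reach-free (reach w∈A)

  closed-reach : ∀ {A u w} → Closed A → u ∈ A → Reach H X u w → w ∈ A
  closed-reach closed u∈A (here _) = u∈A
  closed-reach closed u∈A (step reach w∉X adj) = closed (closed-reach closed u∈A reach) w∉X adj

  closed-∪ : ∀ {A B} → Closed A → Closed B → Closed (A ∪ B)
  closed-∪ {A} {B} closedA closedB v∈A∪B w∉X adj with x∈p∪q⁻ A B v∈A∪B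
  ... | inj₁ v∈A = x∈p∪q⁺ (inj₁ (closedA v∈A w∉X adj))
  ... | inj₂ v∈B = x∈p∪q⁺ (inj₂ (closedB v∈B w∉X adj))

  componentOf : ∀ u → u ∉ X → ComponentOf u
  componentOf u u∉X = grow ⁅ u ⁆ (⊃-wellFounded ⁅ u ⁆) (x∈⁅x⁆ u) λ w∈⁅u⁆ →
    subst (Reach H X u) (sym (x∈⁅y⁆⇒x≡y u w∈⁅u⁆)) (here u∉X)

  rest : Subset (n H) → Subset (n H)
  rest A = ∁ (A ∪ X)

  rest-free : ∀ A → Free (rest A)
  rest-free A _ v∈rest v∈X = x∈∁p⇒x∉p v∈rest (x∈p∪q⁺ (inj₂ v∈X))

  rest-disjoint : ∀ A v → v ∈ A → v ∉ rest A
  rest-disjoint A _ v∈A v∈rest = x∈∁p⇒x∉p v∈rest (x∈p∪q⁺ (inj₁ v∈A))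

  module _ {r : ℕ} (f : Fin r → Fin (m H)) where

    Meets : Subset (n H) → Fin r → Set
    Meets A j = ∃ λ v → v ∈ A × v ∈ edge H (f j)

    meets? : ∀ A j → Dec (Meets A j)
    meets? A j = any? λ v → v ∈? A ×-dec v ∈? edge H (f j)

    hitting : Subset (n H) → Subset r
    hitting A = tabulate (does ∘ meets? A)

    μ : Subset (n H) → ℕ
    μ A = ∣ hitting A ∣

    μ-covers : ∀ {U} → (∀ v → v ∈ U → ∃ λ j → v ∈ edge H (f j)) →
               ∀ A → Covers H (U ∩ A) (μ A)
    μ-covers {U} f-covers A = f ∘ g , covered
      where
      g = proj₁ (enumerate (hitting A))
      covered : ∀ v → v ∈ U ∩ A → ∃ λ k → v ∈ edge H (f (g k))
      covered v v∈U∩A with x∈p∩q⁻ U A v∈U∩A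
      ... | v∈U , v∈A with f-covers v v∈U
      ... | j , v∈fj
        with proj₂ (enumerate (hitting A)) (∈-tabulate-does⁺ (meets? A) (v , v∈A , v∈fj))
      ... | k , refl = k , v∈fj

    μ-∪ : ∀ A B → μ (A ∪ B) ≤ μ A + μ B
    μ-∪ A B = ≤-trans (p⊆q⇒∣p∣≤∣q∣ split) (∣p∪q∣≤∣p∣+∣q∣ (hitting A) (hitting B))
      where
      split : hitting (A ∪ B) ⊆ hitting A ∪ hitting B
      split j∈ with ∈-tabulate-does⁻ (meets? (A ∪ B)) j∈
      ... | v , v∈A∪B , v∈fj with x∈p∪q⁻ A B v∈A∪B
      ... | inj₁ v∈A = x∈p∪q⁺ (inj₁ (∈-tabulate-does⁺ (meets? A) (v , v∈A , v∈fj)))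
      ... | inj₂ v∈B = x∈p∪q⁺ (inj₂ (∈-tabulate-does⁺ (meets? B) (v , v∈B , v∈fj)))

    μ-rest : ∀ A → Closed A → μ A + μ (rest A) ≤ r
    μ-rest A closed = q⊆∁p⇒∣p∣+∣q∣≤n (hitting A) (hitting (rest A)) λ j∈ → x∉p⇒x∈∁p (disjoint j∈)
      where
      disjoint : ∀ {j} → j ∈ hitting (rest A) → j ∉ hitting A
      disjoint j∈rest j∈A with ∈-tabulate-does⁻ (meets? (rest A)) j∈rest
                             | ∈-tabulate-does⁻ (meets? A) j∈A
      ... | w , w∈rest , w∈fj | v , v∈A , v∈fj =
        rest-disjoint A w (closed v∈A (rest-free A w w∈rest) (f _ , v∈fj , w∈fj)) w∈rest

    μ-empty : ∀ A → Empty A → μ A ≡ 0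
    μ-empty A empty = trans (cong ∣_∣ (Empty-unique nothing-hits)) (∣⊥∣≡0 r)
      where
      nothing-hits : Empty (hitting A)
      nothing-hits (j , j∈) with ∈-tabulate-does⁻ (meets? A) j∈
      ... | v , v∈A , _ = empty (v , v∈A)

  ρ<⅔ : ℕ → Subset (n H) → Set
  ρ<⅔ rS U = ∀ r → IsRho H U r → 3 * r < 2 * rS

  BalancedSplit : Subset (n H) → ℕ → Set
  BalancedSplit S rS = Σ (Subset (n H)) λ V₁ → Σ (Subset (n H)) λ V₂ →
    (∀ v → v ∈ V₁ → v ∉ X) × (∀ v → v ∈ V₂ → v ∉ X) ×
    (∀ v → v ∉ X → v ∈ V₁ ⊎ v ∈ V₂) ×
    (∀ v → v ∈ V₁ → v ∉ V₂) ×
    (∀ i → (∀ v → v ∈ edge H i → v ∉ X → v ∈ V₁)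
         ⊎ (∀ v → v ∈ edge H i → v ∉ X → v ∈ V₂)) ×
    ρ<⅔ rS (S ∩ V₁) × ρ<⅔ rS (S ∩ V₂)

  splitAlong : ∀ {S rS} A → Closed A → Free A →
               ρ<⅔ rS (S ∩ A) → ρ<⅔ rS (S ∩ rest A) → BalancedSplit S rS
  splitAlong A closed A∌X A-light rest-light =
    A , rest A , A∌X , rest-free A , A-or-rest , rest-disjoint A , edge-side , A-light , rest-light
    where
    not-rest : ∀ {v} → v ∉ X → v ∉ rest A → v ∈ A
    not-rest {v} v∉X v∉rest with x∈p∪q⁻ A X (x∉∁p⇒x∈p v∉rest)
    ... | inj₁ v∈A = v∈A
    ... | inj₂ v∈X = ⊥-elim (v∉X v∈X)
    A-or-rest : ∀ v → v ∉ X → v ∈ A ⊎ v ∈ rest A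
    A-or-rest v v∉X with v ∈? rest A
    ... | yes v∈rest = inj₂ v∈rest
    ... | no v∉rest = inj₁ (not-rest v∉X v∉rest)
    edge-side : ∀ i → (∀ v → v ∈ edge H i → v ∉ X → v ∈ A)
                    ⊎ (∀ v → v ∈ edge H i → v ∉ X → v ∈ rest A)
    edge-side i with any? (λ v → v ∈? A ×-dec v ∈? edge H i)
    ... | yes (v , v∈A , v∈i) = inj₁ λ w w∈i w∉X → closed v∈A w∉X (i , v∈i , w∈i)
    ... | no misses = inj₂ λ w w∈i w∉X →
      decidable-stable (w ∈? rest A) λ w∉rest → misses (w , not-rest w∉X w∉rest , w∈i)

  free-∪ : ∀ {A B} → Free A → Free B → Free (A ∪ B)
  free-∪ {A} {B} A∌X B∌X v v∈A∪B = [ A∌X v , B∌X v ]′ (x∈p∪q⁻ A B v∈A∪B)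

  module Sweep {S : Subset (n H)} {rS : ℕ} (ρS : IsRho H S rS)
               (3∤rS : ¬ (3 ∣ rS)) (separator : BalancedSeparator H S X) where

    cover : Fin rS → Fin (m H)
    cover = proj₁ (proj₁ ρS)

    ν : Subset (n H) → ℕ
    ν = μ cover

    light-by-ν : ∀ A → 3 * ν A < 2 * rS → ρ<⅔ rS (S ∩ A)
    light-by-ν A 3ν<2rS r (_ , minimal) =
      ≤-<-trans (*-monoʳ-≤ 3 (minimal (ν A) (μ-covers cover (proj₂ (proj₁ ρS)) A))) 3ν<2rS

    rest-light : ∀ A → Closed A → rS < 3 * ν A → ρ<⅔ rS (S ∩ rest A)
    rest-light A closed big =
      light-by-ν (rest A) (thirds-complement (ν A) (ν (rest A)) rS (μ-rest cover A closed) big)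

    component-light : ∀ {u} → u ∉ X → ((C , _) : ComponentOf u) → ρ<⅔ rS (S ∩ C)
    component-light {u} u∉X (C , u∈C , closed , reach) r ρ =
      separator rS ρS C isComponent r (subst (λ U → IsRho H U r) (∩-comm S C) ρ)
      where
      isComponent : IsComponent H X C
      isComponent = u , u∉X , λ w → reach , closed-reach closed u∈C

    overflow : ∀ {u} A → Closed A → Free A → 3 * ν A < rS → u ∉ X →
               ((C , _) : ComponentOf u) → ¬ (3 * ν (A ∪ C) < rS) → BalancedSplit S rS
    overflow A closedA A∌X small u∉X component@(C , _ , closedC , reach) ¬small
      with 3 * ν (A ∪ C) <? 2 * rS
    ... | yes A∪C-light =
      splitAlong {S} {rS} (A ∪ C) (closed-∪ closedA closedC) (free-∪ A∌X (reachable-free reach))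
        (light-by-ν (A ∪ C) A∪C-light) (rest-light (A ∪ C) (closed-∪ closedA closedC) big)
      where
      big : rS < 3 * ν (A ∪ C)
      big = ≮⇒>-nonMultiple (ν (A ∪ C)) rS 3∤rS ¬small
    ... | no A∪C-heavy =
      splitAlong {S} {rS} C closedC (reachable-free reach) (component-light u∉X component)
        (rest-light C closedC
          (thirds-crossing (ν A) (ν (A ∪ C)) (ν C) rS small (μ-∪ cover A C) (≮⇒≥ A∪C-heavy)))

    sweep : (us : List (Fin (n H))) (A : Subset (n H)) → Closed A → Free A → 3 * ν A < rS →
            (∀ w → w ∉ X → w ∈ A ⊎ w ∈ₗ us) → BalancedSplit S rS
    sweep [] A closed A∌X small covered =
      splitAlong {S} {rS} A closed A∌X (light-by-ν A (m<n⇒m<o*n 2 small)) rest-light′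
      where
      rest-empty : Empty (rest A)
      rest-empty (w , w∈rest) with covered w (rest-free A w w∈rest)
      ... | inj₁ w∈A = rest-disjoint A w w∈A w∈rest
      rest-light′ : ρ<⅔ rS (S ∩ rest A)
      rest-light′ = light-by-ν (rest A)
        (subst (λ k → 3 * k < 2 * rS) (sym (μ-empty cover (rest A) rest-empty))
               (m<n⇒m<o*n 2 (≤-<-trans z≤n small)))
    sweep (u ∷ us) A closed A∌X small covered with u ∈? X
    ... | yes u∈X = sweep us A closed A∌X small covered′
      where
      covered′ : ∀ w → w ∉ X → w ∈ A ⊎ w ∈ₗ us
      covered′ w w∉X with covered w w∉X
      ... | inj₁ w∈A = inj₁ w∈A
      ... | inj₂ (Any.here refl) = ⊥-elim (w∉X u∈X)
      ... | inj₂ (Any.there w∈us) = inj₂ w∈us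
    ... | no u∉X with componentOf u u∉X
    ... | component@(C , u∈C , closedC , reach) with 3 * ν (A ∪ C) <? rS
    ... | no ¬small = overflow A closed A∌X small u∉X component ¬small
    ... | yes small′ =
      sweep us (A ∪ C) (closed-∪ closed closedC) (free-∪ A∌X (reachable-free reach)) small′ covered′
      where
      covered′ : ∀ w → w ∉ X → w ∈ A ∪ C ⊎ w ∈ₗ us
      covered′ w w∉X with covered w w∉X
      ... | inj₁ w∈A = inj₁ (x∈p∪q⁺ (inj₁ w∈A))
      ... | inj₂ (Any.here refl) = inj₁ (x∈p∪q⁺ (inj₂ u∈C))
      ... | inj₂ (Any.there w∈us) = inj₂ w∈us

    balancedSplit : 0 < rS → BalancedSplit S rS
    balancedSplit 0<rS =
      sweep (allFin (n H)) ⊥ (⊥-elim ∘ ∉⊥) (λ _ → ⊥-elim ∘ ∉⊥) ⊥-small (λ w _ → inj₂ (∈-allFin w))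
      where
      ⊥-small : 3 * ν ⊥ < rS
      ⊥-small = subst (λ k → 3 * k < rS) (sym (μ-empty cover ⊥ λ (_ , v∈⊥) → ∉⊥ v∈⊥)) 0<rS

mainTheorem15 : (H : Hypergraph) (k : ℕ) → 0 < k →
    (S X : Subset (n H)) (rS rX : ℕ) →
    IsRho H S rS → 3 * k < rS → ¬ (3 ∣ rS) →
    BalancedSeparator H S X → IsRho H X rX → rX ≤ k →
    Σ (Subset (n H)) λ V₁ → Σ (Subset (n H)) λ V₂ →
      (∀ v → v ∈ V₁ → v ∉ X) × (∀ v → v ∈ V₂ → v ∉ X) ×
      (∀ v → v ∉ X → v ∈ V₁ ⊎ v ∈ V₂) ×
      (∀ v → v ∈ V₁ → v ∉ V₂) ×
      (∀ i → (∀ v → v ∈ edge H i → v ∉ X → v ∈ V₁)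
           ⊎ (∀ v → v ∈ edge H i → v ∉ X → v ∈ V₂)) ×
      (∀ r → IsRho H (S ∩ V₁) r → 3 * r < 2 * rS) ×
      (∀ r → IsRho H (S ∩ V₂) r → 3 * r < 2 * rS)
mainTheorem15 H k _ S X rS _ ρS 3k<rS 3∤rS separator _ _ =
  Sweep.balancedSplit H X ρS 3∤rS separator (≤-<-trans z≤n 3k<rS)
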